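{- Let $G$ be a finite simple graph and $a$ a vertex of $G$. Then \[ J(G\mid a\notin W)=y\,J(G-a)+(1-y)\,J(G\mid N_G[a]\cap W=\emptyset). \]
   Context: For a finite simple graph $G$ and $W\subseteq V(G)$, $N_G[W]$ is the set of vertices that are in $W$ or adjacent to a vertex of $W$, and $N_G(W):=N_G[W]\setminus W$; for a vertex $a$, $N_G[a]$ is $a$ together with its neighbours. The bivariate domination polynomial is $J(G;x,y)=J(G):=\sum_{W\subseteq V(G)} x^{|W|}y^{|N_G(W)|}$. For a condition $c(W)$ on subsets $W\subseteq V(G)$, $J(G\mid c(W))$ is the same sum taken only over those $W$ satisfying $c(W)$. $G-a$ is the graph obtained by deleting $a$. -}

module Defs where

open import Level using (Level)
open import Data.Nat using (ℕ; zero; suc)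
open import Data.Bool using (Bool; true; false; _∧_; _∨_; not; if_then_else_)
open import Data.Fin using (Fin; zero; suc; punchIn; _≟_)
open import Data.List using (List; []; _∷_; map; _++_; foldr)
open import Relation.Nullary.Decidable using (⌊_⌋)
open import Relation.Binary.PropositionalEquality using (_≡_)
open import Algebra.Bundles using (CommutativeRing)

record Graph (n : ℕ) : Set where
  field
    adj   : Fin n → Fin n → Bool
    sym   : ∀ u v → adj u v ≡ adj v u
    irrefl : ∀ v → adj v v ≡ false
open Graph public

-- G - a  (vertex set Fin (suc n) minus a, relabelled as Fin n via punchIn a)
delete : ∀ {n} → Graph (suc n) → Fin (suc n) → Graph n
delete G a = record
  { adj = λ u v → adj G (punchIn a u) (punchIn a v)
  ; sym = λ u v → sym G (punchIn a u) (punchIn a v)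
  ; irrefl = λ v → irrefl G (punchIn a v) }

VSet : ℕ → Set
VSet n = Fin n → Bool

anyFin : ∀ n → (Fin n → Bool) → Bool
anyFin zero    p = false
anyFin (suc n) p = p zero ∨ anyFin n (λ i → p (suc i))

countFin : ∀ n → (Fin n → Bool) → ℕ
countFin zero    p = 0
countFin (suc n) p = (if p zero then 1 else 0) Data.Nat.+ countFin n (λ i → p (suc i))

allSubsets : ∀ n → List (VSet n)
allSubsets zero    = (λ ()) ∷ []
allSubsets (suc n) =
  map (λ W → λ { zero → false ; (suc i) → W i }) (allSubsets n) ++
  map (λ W → λ { zero → true  ; (suc i) → W i }) (allSubsets n)

card : ∀ {n} → VSet n → ℕ
card {n} W = countFin n W

inOpenNbhd : ∀ {n} → Graph n → VSet n → Fin n → Bool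
inOpenNbhd {n} G W v = not (W v) ∧ anyFin n (λ w → W w ∧ adj G w v)

nbhdSize : ∀ {n} → Graph n → VSet n → ℕ
nbhdSize {n} G W = countFin n (inOpenNbhd G W)

inClosedNbhd : ∀ {n} → Graph n → Fin n → Fin n → Bool
inClosedNbhd G a v = ⌊ v ≟ a ⌋ ∨ adj G a v

module _ {c ℓ : Level} (R : CommutativeRing c ℓ) where
  open CommutativeRing R

  pow : Carrier → ℕ → Carrier
  pow z zero    = 1#
  pow z (suc k) = z * pow z k

  Jc : ∀ {n} → Graph n → (VSet n → Bool) → Carrier → Carrier → Carrier
  Jc {n} G cond x y =
    foldr (λ W acc → (if cond W then pow x (card W) * pow y (nbhdSize G W) else 0#) + acc)
          0# (allSubsets n)

  J : ∀ {n} → Graph n → Carrier → Carrier → Carrier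
  J G x y = Jc G (λ _ → true) x y

notIn : ∀ {n} → Fin n → VSet n → Bool
notIn a W = not (W a)

closedNbhdDisjoint : ∀ {n} → Graph n → Fin n → VSet n → Bool
closedNbhdDisjoint {n} G a W = not (anyFin n (λ v → inClosedNbhd G a v ∧ W v))

-- Every subset of V(G) = Fin (suc n) is obtained from a subset W of
-- V(G - a) = Fin n by declaring whether a belongs to it ('extend a b W').
-- Splitting the sums over all subsets along this bijection, the subsets
-- containing a contribute nothing to either conditional sum.  For a subset
-- not containing a, |W| is unchanged and N_G(W) is N_{G-a}(W) plus possibly
-- the vertex a itself, which happens exactly when a has a neighbour in W,
-- i.e. exactly when N_G[a] ∩ W ≠ ∅.  In both cases the summands satisfy the
-- formula termwise, so it follows by linearity of the sum.
module Submission where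

open import Defs
open import Level using (Level)
open import Data.Nat using (ℕ; zero; suc) renaming (_+_ to _+ℕ_)
import Data.Nat.Properties as ℕ
open import Data.Fin using (Fin; zero; suc; punchIn; _≟_)
open import Data.Fin.Properties using (punchInᵢ≢i)
open import Data.Bool using (Bool; true; false; _∧_; _∨_; not; if_then_else_)
open import Data.Bool.Properties using (∨-commutativeMonoid; ∧-comm; ∧-zeroʳ)
open import Data.List using (List; []; _∷_; map; _++_; foldr)
open import Relation.Nullary using (yes; no; contradiction)
open import Relation.Nullary.Decidable using (⌊_⌋)
open import Relation.Binary.PropositionalEquality
  using (_≡_; refl; cong; cong₂; module ≡-Reasoning)
import Relation.Binary.PropositionalEquality as ≡
open import Algebra.Bundles using (CommutativeRing; CommutativeMonoid)
import Algebra.Properties.CommutativeSemigroup as CommSemigroupProps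
import Relation.Binary.Reasoning.Setoid as SetoidReasoning

bit : Bool → ℕ
bit b = if b then 1 else 0

-- Pointwise equality of subsets (subsets are functions, so '≡' is too strong).
_≗_ : ∀ {n} → VSet n → VSet n → Set
W ≗ W' = ∀ i → W i ≡ W' i

-- The subset of Fin (suc n) that contains a iff b, and whose trace on the
-- remaining vertices (relabelled by 'punchIn a', as in 'delete') is W.
extend : ∀ {n} → Fin (suc n) → Bool → VSet n → VSet (suc n)
extend         zero    b W zero    = b
extend         zero    b W (suc i) = W i
extend {zero}  (suc ()) b W v
extend {suc n} (suc a) b W zero    = W zero
extend {suc n} (suc a) b W (suc i) = extend a b (λ j → W (suc j)) i

extend-at : ∀ {n} (a : Fin (suc n)) b W → extend a b W a ≡ b
extend-at         zero    b W = refl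
extend-at {zero}  (suc ()) b W
extend-at {suc n} (suc a) b W = extend-at a b (λ j → W (suc j))

extend-punchIn : ∀ {n} (a : Fin (suc n)) b W i → extend a b W (punchIn a i) ≡ W i
extend-punchIn         zero    b W i       = refl
extend-punchIn {zero}  (suc ()) b W i
extend-punchIn {suc n} (suc a) b W zero    = refl
extend-punchIn {suc n} (suc a) b W (suc i) = extend-punchIn a b (λ j → W (suc j)) i

extend-cong : ∀ {n} (a : Fin (suc n)) b {W W' : VSet n} → W ≗ W' → extend a b W ≗ extend a b W'
extend-cong         zero    b e zero    = refl
extend-cong         zero    b e (suc i) = e i
extend-cong {zero}  (suc ()) b e v
extend-cong {suc n} (suc a) b e zero    = e zero
extend-cong {suc n} (suc a) b e (suc i) = extend-cong a b (λ j → e (suc j)) i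

-- Deciding vertex 0 and vertex (suc a) commute; used to move the splitting
-- vertex from 0 to an arbitrary position.
extend-comm : ∀ {n} (a : Fin (suc n)) b c (W : VSet n) →
  extend zero b (extend a c W) ≗ extend (suc a) c (extend zero b W)
extend-comm a b c W zero    = refl
extend-comm a b c W (suc i) = refl

countFin-cong : ∀ n {p q : Fin n → Bool} → (∀ i → p i ≡ q i) → countFin n p ≡ countFin n q
countFin-cong zero    e = refl
countFin-cong (suc n) e = cong₂ (λ b r → bit b +ℕ r) (e zero) (countFin-cong n (λ i → e (suc i)))

anyFin-cong : ∀ n {p q : Fin n → Bool} → (∀ i → p i ≡ q i) → anyFin n p ≡ anyFin n q
anyFin-cong zero    e = refl
anyFin-cong (suc n) e = cong₂ _∨_ (e zero) (anyFin-cong n (λ i → e (suc i)))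

countFin-punchIn : ∀ n (a : Fin (suc n)) p →
  countFin (suc n) p ≡ bit (p a) +ℕ countFin n (λ i → p (punchIn a i))
countFin-punchIn n       zero    p = refl
countFin-punchIn zero    (suc ()) p
countFin-punchIn (suc n) (suc a) p = begin
  bit (p zero) +ℕ countFin (suc n) (λ i → p (suc i))
    ≡⟨ cong (bit (p zero) +ℕ_) (countFin-punchIn n a (λ i → p (suc i))) ⟩
  bit (p zero) +ℕ (bit (p (suc a)) +ℕ _)
    ≡⟨ CommSemigroupProps.x∙yz≈y∙xz ℕ.+-commutativeSemigroup (bit (p zero)) (bit (p (suc a))) _ ⟩
  bit (p (suc a)) +ℕ (bit (p zero) +ℕ _) ∎
  where open ≡-Reasoning

anyFin-punchIn : ∀ n (a : Fin (suc n)) p →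
  anyFin (suc n) p ≡ p a ∨ anyFin n (λ i → p (punchIn a i))
anyFin-punchIn n       zero    p = refl
anyFin-punchIn zero    (suc ()) p
anyFin-punchIn (suc n) (suc a) p = begin
  p zero ∨ anyFin (suc n) (λ i → p (suc i))
    ≡⟨ cong (p zero ∨_) (anyFin-punchIn n a (λ i → p (suc i))) ⟩
  p zero ∨ (p (suc a) ∨ _)
    ≡⟨ CommSemigroupProps.x∙yz≈y∙xz ∨-commutativeSemigroup (p zero) (p (suc a)) _ ⟩
  p (suc a) ∨ (p zero ∨ _) ∎
  where
  open ≡-Reasoning
  ∨-commutativeSemigroup = CommutativeMonoid.commutativeSemigroup ∨-commutativeMonoid

card-cong : ∀ {n} {W W' : VSet n} → W ≗ W' → card W ≡ card W'
card-cong {n} = countFin-cong n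

nbhdSize-cong : ∀ {n} (G : Graph n) {W W' : VSet n} → W ≗ W' → nbhdSize G W ≡ nbhdSize G W'
nbhdSize-cong {n} G e = countFin-cong n λ v →
  cong₂ _∧_ (cong not (e v)) (anyFin-cong n (λ w → cong (_∧ adj G w v) (e w)))

card-extend : ∀ {n} (a : Fin (suc n)) b W → card (extend a b W) ≡ bit b +ℕ card W
card-extend {n} a b W =
  ≡.trans (countFin-punchIn n a (extend a b W))
          (cong₂ (λ u r → bit u +ℕ r) (extend-at a b W) (countFin-cong n (extend-punchIn a b W)))

anyFin-extend : ∀ {n} (a : Fin (suc n)) b W (q : Fin (suc n) → Bool) →
  anyFin (suc n) (λ w → extend a b W w ∧ q w) ≡ (b ∧ q a) ∨ anyFin n (λ w → W w ∧ q (punchIn a w))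
anyFin-extend {n} a b W q =
  ≡.trans (anyFin-punchIn n a (λ w → extend a b W w ∧ q w))
          (cong₂ _∨_ (cong (_∧ q a) (extend-at a b W))
                     (anyFin-cong n (λ w → cong (_∧ q (punchIn a w)) (extend-punchIn a b W w))))

adjacentTo : ∀ {n} → Graph (suc n) → Fin (suc n) → VSet n → Bool
adjacentTo {n} G a W = anyFin n (λ w → W w ∧ adj G (punchIn a w) a)

nbhdSize-extend : ∀ {n} (G : Graph (suc n)) a W →
  nbhdSize G (extend a false W) ≡ bit (adjacentTo G a W) +ℕ nbhdSize (delete G a) W
nbhdSize-extend {n} G a W =
  ≡.trans (countFin-punchIn n a (inOpenNbhd G (extend a false W)))
          (cong₂ (λ u r → bit u +ℕ r) at-a (countFin-cong n elsewhere))
  where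
  at-a : inOpenNbhd G (extend a false W) a ≡ adjacentTo G a W
  at-a = ≡.trans (cong (λ u → not u ∧ anyFin (suc n) (λ w → extend a false W w ∧ adj G w a))
                       (extend-at a false W))
                 (anyFin-extend a false W (λ w → adj G w a))
  elsewhere : ∀ i → inOpenNbhd G (extend a false W) (punchIn a i) ≡ inOpenNbhd (delete G a) W i
  elsewhere i = cong₂ _∧_ (cong not (extend-punchIn a false W i))
                          (anyFin-extend a false W (λ w → adj G w (punchIn a i)))

punchIn-≢ : ∀ {n} (a : Fin (suc n)) v → ⌊ punchIn a v ≟ a ⌋ ≡ false
punchIn-≢ a v with punchIn a v ≟ a
... | yes eq = contradiction eq (punchInᵢ≢i a v)
... | no _   = refl

≟-refl : ∀ {n} (a : Fin n) → ⌊ a ≟ a ⌋ ≡ true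
≟-refl a with a ≟ a
... | yes _ = refl
... | no ne = contradiction refl ne

closedNbhdDisjoint-extend-false : ∀ {n} (G : Graph (suc n)) a W →
  closedNbhdDisjoint G a (extend a false W) ≡ not (adjacentTo G a W)
closedNbhdDisjoint-extend-false {n} G a W = cong not
  (≡.trans (anyFin-punchIn n a (λ v → inClosedNbhd G a v ∧ extend a false W v))
           (cong₂ _∨_ (≡.trans (cong (inClosedNbhd G a a ∧_) (extend-at a false W)) (∧-zeroʳ _))
                      (anyFin-cong n trace)))
  where
  trace : ∀ v → inClosedNbhd G a (punchIn a v) ∧ extend a false W (punchIn a v) ≡ W v ∧ adj G (punchIn a v) a
  trace v = begin
    (⌊ punchIn a v ≟ a ⌋ ∨ adj G a (punchIn a v)) ∧ extend a false W (punchIn a v)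
      ≡⟨ cong₂ (λ u r → (u ∨ adj G a (punchIn a v)) ∧ r) (punchIn-≢ a v) (extend-punchIn a false W v) ⟩
    adj G a (punchIn a v) ∧ W v
      ≡⟨ ∧-comm (adj G a (punchIn a v)) (W v) ⟩
    W v ∧ adj G a (punchIn a v)
      ≡⟨ cong (W v ∧_) (sym G a (punchIn a v)) ⟩
    W v ∧ adj G (punchIn a v) a ∎
    where open ≡-Reasoning

closedNbhdDisjoint-extend-true : ∀ {n} (G : Graph (suc n)) a W →
  closedNbhdDisjoint G a (extend a true W) ≡ false
closedNbhdDisjoint-extend-true {n} G a W = cong not
  (≡.trans (anyFin-punchIn n a (λ v → inClosedNbhd G a v ∧ extend a true W v))
           (cong (_∨ anyFin n (λ i → inClosedNbhd G a (punchIn a i) ∧ extend a true W (punchIn a i)))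
                 (cong₂ (λ u r → (u ∨ adj G a a) ∧ r) (≟-refl a) (extend-at a true W))))

module RingSums {c ℓ : Level} (R : CommutativeRing c ℓ) where
  open CommutativeRing R
    renaming (refl to ≈-refl; sym to ≈-sym; trans to ≈-trans)
    hiding (zero)
  open SetoidReasoning setoid
  module +-Props = CommSemigroupProps +-commutativeSemigroup
  module *-Props = CommSemigroupProps *-commutativeSemigroup

  sumOver : ∀ {n} → (VSet n → Carrier) → List (VSet n) → Carrier
  sumOver f = foldr (λ W acc → f W + acc) 0#

  Σ : ∀ n → (VSet n → Carrier) → Carrier
  Σ n f = sumOver f (allSubsets n)

  sumOver-++ : ∀ {n} (f : VSet n → Carrier) xs ys → sumOver f (xs ++ ys) ≈ sumOver f xs + sumOver f ys
  sumOver-++ f []       ys = ≈-sym (+-identityˡ _)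
  sumOver-++ f (x ∷ xs) ys = ≈-trans (+-congˡ (sumOver-++ f xs ys)) (≈-sym (+-assoc _ _ _))

  sumOver-map : ∀ {m n} (f : VSet n → Carrier) (g : VSet m → VSet n) xs →
    sumOver f (map g xs) ≈ sumOver (λ W → f (g W)) xs
  sumOver-map f g []       = ≈-refl
  sumOver-map f g (x ∷ xs) = +-congˡ (sumOver-map f g xs)

  sumOver-cong : ∀ {n} {f g : VSet n → Carrier} → (∀ W → f W ≈ g W) → ∀ xs → sumOver f xs ≈ sumOver g xs
  sumOver-cong e []       = ≈-refl
  sumOver-cong e (x ∷ xs) = +-cong (e x) (sumOver-cong e xs)

  sumOver-+ : ∀ {n} (f g : VSet n → Carrier) xs → sumOver (λ W → f W + g W) xs ≈ sumOver f xs + sumOver g xs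
  sumOver-+ f g []       = ≈-sym (+-identityˡ _)
  sumOver-+ f g (x ∷ xs) = ≈-trans (+-congˡ (sumOver-+ f g xs)) (+-Props.interchange _ _ _ _)

  sumOver-* : ∀ {n} k (f : VSet n → Carrier) xs → sumOver (λ W → k * f W) xs ≈ k * sumOver f xs
  sumOver-* k f []       = ≈-sym (zeroʳ k)
  sumOver-* k f (x ∷ xs) = ≈-trans (+-congˡ (sumOver-* k f xs)) (≈-sym (distribˡ _ _ _))

  sumOver-0 : ∀ {n} {f : VSet n → Carrier} → (∀ W → f W ≈ 0#) → ∀ xs → sumOver f xs ≈ 0#
  sumOver-0 e []       = ≈-refl
  sumOver-0 e (x ∷ xs) = ≈-trans (+-cong (e x) (sumOver-0 e xs)) (+-identityˡ 0#)

  Respects≗ : ∀ {n} → (VSet n → Carrier) → Set ℓ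
  Respects≗ {n} f = ∀ {W W' : VSet n} → W ≗ W' → f W ≈ f W'

  Σ-cong : ∀ n {f g : VSet n → Carrier} → (∀ W → f W ≈ g W) → Σ n f ≈ Σ n g
  Σ-cong n e = sumOver-cong e (allSubsets n)

  -- Splitting a sum over subsets according to membership of vertex 0 ...
  -- ('allSubsets' builds these subsets by pattern-matching lambdas, which
  -- agree with 'extend zero b' only pointwise; hence the Respects≗ hypothesis.)
  Σ-split-zero : ∀ n (f : VSet (suc n) → Carrier) → Respects≗ f →
    Σ (suc n) f ≈ Σ n (λ W → f (extend zero false W)) + Σ n (λ W → f (extend zero true W))
  Σ-split-zero n f resp = ≈-trans (sumOver-++ f (map _ L) (map _ L))
    (+-cong (≈-trans (sumOver-map f _ L) (sumOver-cong (λ W → resp λ { zero → refl ; (suc i) → refl }) L))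
            (≈-trans (sumOver-map f _ L) (sumOver-cong (λ W → resp λ { zero → refl ; (suc i) → refl }) L)))
    where L = allSubsets n

  respects-extend : ∀ {n} (a : Fin (suc n)) b {f : VSet (suc n) → Carrier} →
    Respects≗ f → Respects≗ (λ W → f (extend a b W))
  respects-extend a b resp e = resp (extend-cong a b e)

  -- ... and of an arbitrary vertex a, by moving a to position 0.
  Σ-split : ∀ n (a : Fin (suc n)) (f : VSet (suc n) → Carrier) → Respects≗ f →
    Σ (suc n) f ≈ Σ n (λ W → f (extend a false W)) + Σ n (λ W → f (extend a true W))
  Σ-split n       zero    f resp = Σ-split-zero n f resp
  Σ-split zero    (suc ()) f resp
  Σ-split (suc n) (suc a) f resp = begin
    Σ (suc (suc n)) f
      ≈⟨ Σ-split-zero (suc n) f resp ⟩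
    Σ (suc n) (λ W → f (extend zero false W)) + Σ (suc n) (λ W → f (extend zero true W))
      ≈⟨ +-cong (Σ-split n a _ (respects-extend zero false resp))
                (Σ-split n a _ (respects-extend zero true resp)) ⟩
    (Σ₂ false false + Σ₂ false true) + (Σ₂ true false + Σ₂ true true)
      ≈⟨ +-Props.interchange _ _ _ _ ⟩
    (Σ₂ false false + Σ₂ true false) + (Σ₂ false true + Σ₂ true true)
      ≈⟨ +-cong (+-cong (reorder false false) (reorder true false))
                (+-cong (reorder false true) (reorder true true)) ⟩
    (Σ₂' false false + Σ₂' true false) + (Σ₂' false true + Σ₂' true true)
      ≈⟨ ≈-sym (+-cong (Σ-split-zero n _ (respects-extend (suc a) false resp))
                       (Σ-split-zero n _ (respects-extend (suc a) true resp))) ⟩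
    Σ (suc n) (λ W → f (extend (suc a) false W)) + Σ (suc n) (λ W → f (extend (suc a) true W)) ∎
    where
    Σ₂ Σ₂' : Bool → Bool → Carrier
    Σ₂  b c = Σ n (λ W → f (extend zero b (extend a c W)))
    Σ₂' b c = Σ n (λ W → f (extend (suc a) c (extend zero b W)))
    reorder : ∀ b c → Σ₂ b c ≈ Σ₂' b c
    reorder b c = Σ-cong n (λ W → resp (extend-comm a b c W))

  Σ-avoiding : ∀ n (a : Fin (suc n)) (f : VSet (suc n) → Carrier) → Respects≗ f →
    (∀ W → f (extend a true W) ≈ 0#) → Σ (suc n) f ≈ Σ n (λ W → f (extend a false W))
  Σ-avoiding n a f resp vanish = begin
    Σ (suc n) f                                                          ≈⟨ Σ-split n a f resp ⟩
    Σ n (λ W → f (extend a false W)) + Σ n (λ W → f (extend a true W))  ≈⟨ +-congˡ (sumOver-0 vanish (allSubsets n)) ⟩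
    Σ n (λ W → f (extend a false W)) + 0#                                ≈⟨ +-identityʳ _ ⟩
    Σ n (λ W → f (extend a false W))                                     ∎

  Σ-linear : ∀ n k l (f g : VSet n → Carrier) → Σ n (λ W → k * f W + l * g W) ≈ k * Σ n f + l * Σ n g
  Σ-linear n k l f g = ≈-trans (sumOver-+ (λ W → k * f W) (λ W → l * g W) L)
                               (+-cong (sumOver-* k f L) (sumOver-* l g L))
    where L = allSubsets n

  weight : Carrier → Carrier → Bool → ℕ → ℕ → Carrier
  weight x y u k d = if u then pow R x k * pow R y d else 0#

  weight-cong : ∀ x y {u u' k k' d d'} → u ≡ u' → k ≡ k' → d ≡ d' → weight x y u k d ≈ weight x y u' k' d'
  weight-cong x y refl refl refl = ≈-refl

  weight-off : ∀ x y {u} k d → u ≡ false → weight x y u k d ≈ 0#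
  weight-off x y k d refl = ≈-refl

  -- J(G | cond) = Σ (term G cond x y), definitionally.
  term : ∀ {n} → Graph n → (VSet n → Bool) → Carrier → Carrier → VSet n → Carrier
  term G cond x y W = weight x y (cond W) (card W) (nbhdSize G W)

  term-respects : ∀ {n} (G : Graph n) (cond : VSet n → Bool) x y →
    (∀ {W W'} → W ≗ W' → cond W ≡ cond W') → Respects≗ (term G cond x y)
  term-respects G cond x y cond-resp e = weight-cong x y (cond-resp e) (card-cong e) (nbhdSize-cong G e)

  complement : ∀ y → y + (1# - y) ≈ 1#
  complement y = ≈-trans (+-Props.x∙yz≈y∙xz y 1# (- y)) (≈-trans (+-congˡ (-‿inverseʳ y)) (+-identityʳ 1#))

  -- The termwise identity: if the extra neighbour a is present (m = true) the
  -- summand gains a factor y and the second condition fails; otherwise the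
  -- summand is split as y·T + (1 - y)·T.
  adjacency-split : ∀ x y k (m : Bool) d →
    weight x y true k (bit m +ℕ d) ≈ y * weight x y true k d + (1# - y) * weight x y (not m) k (bit m +ℕ d)
  adjacency-split x y k true d = begin
    pow R x k * (y * pow R y d)                    ≈⟨ *-Props.x∙yz≈y∙xz (pow R x k) y (pow R y d) ⟩
    y * (pow R x k * pow R y d)                    ≈⟨ ≈-sym (+-identityʳ _) ⟩
    y * (pow R x k * pow R y d) + 0#               ≈⟨ +-congˡ (≈-sym (zeroʳ (1# - y))) ⟩
    y * (pow R x k * pow R y d) + (1# - y) * 0#    ∎
  adjacency-split x y k false d = begin
    T                     ≈⟨ ≈-sym (*-identityˡ T) ⟩
    1# * T                ≈⟨ *-congʳ (≈-sym (complement y)) ⟩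
    (y + (1# - y)) * T    ≈⟨ distribʳ T y (1# - y) ⟩
    y * T + (1# - y) * T  ∎
    where T = pow R x k * pow R y d

  module _ {n : ℕ} (G : Graph (suc n)) (a : Fin (suc n)) (x y : Carrier) where
    avoid delt disj : VSet _ → Carrier
    avoid = term G (notIn a) x y
    delt  = term (delete G a) (λ _ → true) x y
    disj  = term G (closedNbhdDisjoint G a) x y

    avoid-respects : Respects≗ avoid
    avoid-respects = term-respects G (notIn a) x y (λ e → cong not (e a))

    disj-respects : Respects≗ disj
    disj-respects = term-respects G (closedNbhdDisjoint G a) x y
      (λ e → cong not (anyFin-cong (suc n) (λ v → cong (inClosedNbhd G a v ∧_) (e v))))

    avoid-vanishes : ∀ W → avoid (extend a true W) ≈ 0#
    avoid-vanishes W = weight-off x y (card (extend a true W)) (nbhdSize G (extend a true W))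
                                   (cong not (extend-at a true W))

    disj-vanishes : ∀ W → disj (extend a true W) ≈ 0#
    disj-vanishes W = weight-off x y (card (extend a true W)) (nbhdSize G (extend a true W))
                                  (closedNbhdDisjoint-extend-true G a W)

    termwise : ∀ W → avoid (extend a false W) ≈ y * delt W + (1# - y) * disj (extend a false W)
    termwise W = begin
      avoid (extend a false W)
        ≈⟨ weight-cong x y (cong not (extend-at a false W)) (card-extend a false W) (nbhdSize-extend G a W) ⟩
      weight x y true (card W) (bit m +ℕ d)
        ≈⟨ adjacency-split x y (card W) m d ⟩
      y * delt W + (1# - y) * weight x y (not m) (card W) (bit m +ℕ d)
        ≈⟨ +-congˡ (*-congˡ (≈-sym (weight-cong x y (closedNbhdDisjoint-extend-false G a W)
                                                   (card-extend a false W) (nbhdSize-extend G a W)))) ⟩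
      y * delt W + (1# - y) * disj (extend a false W) ∎
      where
      m = adjacentTo G a W
      d = nbhdSize (delete G a) W

corollary2 : ∀ {c ℓ : Level} (R : CommutativeRing c ℓ) {n : ℕ} (G : Graph (suc n)) (a : Fin (suc n))
               (x y : CommutativeRing.Carrier R) →
             let open CommutativeRing R in
             Jc R G (notIn a) x y ≈ y * J R (delete G a) x y + (1# - y) * Jc R G (closedNbhdDisjoint G a) x y
corollary2 R {n} G a x y = begin
  Σ (suc n) (avoid G a x y)
    ≈⟨ Σ-avoiding n a (avoid G a x y) (avoid-respects G a x y) (avoid-vanishes G a x y) ⟩
  Σ n (λ W → avoid G a x y (extend a false W))
    ≈⟨ Σ-cong n (termwise G a x y) ⟩
  Σ n (λ W → y * delt G a x y W + (1# - y) * disj G a x y (extend a false W))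
    ≈⟨ Σ-linear n y (1# - y) (delt G a x y) (λ W → disj G a x y (extend a false W)) ⟩
  y * Σ n (delt G a x y) + (1# - y) * Σ n (λ W → disj G a x y (extend a false W))
    ≈⟨ +-congˡ (*-congˡ (≈-sym (Σ-avoiding n a (disj G a x y) (disj-respects G a x y) (disj-vanishes G a x y)))) ⟩
  y * Σ n (delt G a x y) + (1# - y) * Σ (suc n) (disj G a x y) ∎
  where
  open CommutativeRing R renaming (sym to ≈-sym) hiding (zero)
  open SetoidReasoning setoid
  open RingSums R
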